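{- Let $G$ be a graph with maximum degree at most $5$ and clique number at most $4$. Then every vertex $v$ of $G$ with $k_3(v)=7$ has a neighbor $x$ with $k_3(x)\le 5$.
   Context: All graphs are finite and simple. For a vertex $v$ of a graph $G$, $k_3(v)$ denotes the number of triangles ($K_3$ subgraphs) of $G$ containing $v$. -}

module Defs where

open import Data.Nat using (ℕ; _≤_; _<_)
open import Data.Bool using (Bool; true; false)
open import Data.Fin using (Fin; toℕ)
open import Data.List using (List; length; filter; allFin; concatMap)
open import Data.Product using (_×_; _,_)
open import Relation.Binary.PropositionalEquality using (_≡_)
open import Relation.Nullary using (¬_)
open import Relation.Nullary.Decidable using (_×-dec_)
open import Data.Bool.Properties using (_≟_)
open import Data.Nat.Properties using (_<?_)

record Graph (n : ℕ) : Set where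
  field
    adj   : Fin n → Fin n → Bool
    sym   : ∀ u v → adj u v ≡ adj v u
    irrefl : ∀ v → adj v v ≡ false

open Graph public

Adjacent : ∀ {n} → Graph n → Fin n → Fin n → Set
Adjacent G u v = adj G u v ≡ true

neighbours : ∀ {n} → Graph n → Fin n → List (Fin n)
neighbours {n} G v = filter (λ u → adj G v u ≟ true) (allFin n)

degree : ∀ {n} → Graph n → Fin n → ℕ
degree G v = length (neighbours G v)

MaxDegreeAtMost : ∀ {n} → Graph n → ℕ → Set
MaxDegreeAtMost G d = ∀ v → degree G v ≤ d

-- A clique on 5 vertices (pairwise adjacent; distinctness follows from
-- irreflexivity).  Clique number ≤ 4 means there is no K5.
IsK5 : ∀ {n} → Graph n → Fin n → Fin n → Fin n → Fin n → Fin n → Set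
IsK5 G a b c d e =
  Adjacent G a b × Adjacent G a c × Adjacent G a d × Adjacent G a e ×
  Adjacent G b c × Adjacent G b d × Adjacent G b e ×
  Adjacent G c d × Adjacent G c e ×
  Adjacent G d e

CliqueNumberAtMost4 : ∀ {n} → Graph n → Set
CliqueNumberAtMost4 G = ∀ a b c d e → ¬ IsK5 G a b c d e

-- k3(v): the number of triangles containing v, i.e. the number of
-- unordered pairs {a,b} (counted once via toℕ a < toℕ b) of neighbours
-- of v that are adjacent to each other.
trianglePairs : ∀ {n} → Graph n → Fin n → List (Fin n × Fin n)
trianglePairs {n} G v =
  filter (λ p → let a = Data.Product.proj₁ p ; b = Data.Product.proj₂ p in
                 ((toℕ a <? toℕ b) ×-dec (adj G v a ≟ true)) ×-dec
                 ((adj G v b ≟ true) ×-dec (adj G a b ≟ true)))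
    (concatMap (λ a → Data.List.map (λ b → (a , b)) (allFin n)) (allFin n))

k3 : ∀ {n} → Graph n → Fin n → ℕ
k3 G v = length (trianglePairs G v)

-- Let N be the neighbourhood of v.  Since k3(v) is the number of edges of G[N] and |N| ≤ 5,
-- G[N] has 7 edges, forcing |N| = 5; and G[N] is K4-free, as a K4 in it would form a K5 with v.
-- The complement of G[N] then has three edges, no vertex meeting all of them, so it is a
-- triangle, a P4 or a P3 + K2.  In each case (checked by exhaustive evaluation) some vertex x
-- has exactly two neighbours y, z in G[N], with deg_N y + deg_N z ≥ 6 + [yz].  The neighbours of
-- x are v, y, z and a set O of at most two vertices outside N ∪ {v}.  As y is adjacent to v, to
-- deg_N y vertices of N and to its neighbours in O, it has at most 4 − deg_N y neighbours in O,
-- and likewise for z; hence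
--   k3(x) = 2 + [yz] + e(y, O) + e(z, O) + e(O) ≤ 2 + [yz] + (8 − deg_N y − deg_N z) + 1 ≤ 5.

module Submission where

open import Defs hiding (sym)
open import Data.Bool using (Bool; true; false; _∧_; if_then_else_)
open import Data.Bool.Properties using (_≟_; ∧-zeroʳ; ∧-identityʳ)
open import Data.Empty using (⊥; ⊥-elim)
open import Data.Fin using (Fin; zero; suc; toℕ)
open import Data.Fin.Patterns using (0F; 1F; 2F; 3F; 4F)
open import Data.Fin.Properties using (toℕ-injective; any?; all?) renaming (_≟_ to _≟ᶠ_)
open import Data.List using (List; []; _∷_; _++_; map; concatMap; filter; length; tabulate; allFin)
open import Data.List.Properties using (map-cong; map-++; map-∘; length-++)
open import Data.List.Membership.Propositional using (_∈_)
open import Data.List.Membership.Propositional.Properties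
  using (∈-∃++; ∈-filter⁺; ∈-filter⁻; ∈-allFin; ∈-tabulate⁺; ∈-tabulate⁻)
open import Data.List.Relation.Binary.Permutation.Propositional using (_↭_; ↭-sym; ↭⇒↭ₛ)
import Data.List.Relation.Binary.Permutation.Propositional as ↭
open import Data.List.Relation.Binary.Permutation.Propositional.Properties
  using (∈-resp-↭; ↭-length; shift) renaming (map⁺ to ↭-map⁺)
import Data.List.Relation.Binary.Permutation.Setoid.Properties as ↭ₛ
open import Data.List.Relation.Binary.Subset.Propositional using (_⊆_)
open import Data.List.Relation.Unary.All as All using (All; []; _∷_)
open import Data.List.Relation.Unary.All.Properties using () renaming (++⁺ to All-++⁺)
open import Data.List.Relation.Unary.AllPairs using ([]; _∷_)
open import Data.List.Relation.Unary.Any using (here; there)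
open import Data.List.Relation.Unary.Unique.Propositional using (Unique)
import Data.List.Relation.Unary.Unique.Propositional.Properties as Unique
open import Data.Nat using (ℕ; zero; suc; _+_; _≤_; z≤n; s≤s; s≤s⁻¹)
open import Data.Nat.Combinatorics using (_C_; nC1≡n; nCk+nC[k+1]≡[n+1]C[k+1])
open import Data.Nat.ListAction using (sum)
open import Data.Nat.ListAction.Properties using (sum-++; sum-↭)
open import Data.Nat.Properties
  using (_<?_; _≤?_; <-cmp; suc-injective; +-assoc; +-mono-≤; +-monoˡ-≤; +-cancelʳ-≤;
         m≤m+n; ≤-trans; ≤-reflexive; +-commutativeSemigroup; module ≤-Reasoning)
  renaming (_≟_ to _≟ℕ_)
open import Algebra.Properties.CommutativeSemigroup +-commutativeSemigroup using (interchange)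
open import Data.Nat.Tactic.RingSolver using (solve-∀)
open import Data.Product using (Σ; _×_; _,_; proj₁; proj₂; ∃-syntax)
open import Data.Sum using (_⊎_; inj₁; inj₂)
import Data.Sum as Sum
open import Data.Vec using (Vec; []; _∷_; lookup)
open import Function using (_∘_)
open import Relation.Binary.Definitions using (tri<; tri≈; tri>)
open import Relation.Binary.PropositionalEquality
  using (_≡_; _≢_; refl; sym; trans; cong; cong₂; subst; subst₂; setoid; module ≡-Reasoning)
open import Relation.Nullary using (Dec; does; ¬_; ¬?; _×-dec_; _⊎-dec_; _→-dec_; map′)
open import Relation.Nullary.Decidable using (dec-true; dec-false; from-yes)
open import Relation.Unary using (Decidable)

private variable
  A B : Set

bit : Bool → ℕ
bit true  = 1
bit false = 0

∑ : (A → ℕ) → List A → ℕ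
∑ f xs = sum (map f xs)

count : (A → Bool) → List A → ℕ
count p = ∑ (bit ∘ p)

module _ {f g : A → ℕ} where

  ∑-cong : (∀ x → f x ≡ g x) → ∀ xs → ∑ f xs ≡ ∑ g xs
  ∑-cong f≗g xs = cong sum (map-cong f≗g xs)

  ∑-+ : ∀ xs → ∑ (λ x → f x + g x) xs ≡ ∑ f xs + ∑ g xs
  ∑-+ []       = refl
  ∑-+ (x ∷ xs) = trans (cong (f x + g x +_) (∑-+ xs)) (interchange (f x) (g x) _ _)

∑-++ : (f : A → ℕ) (xs ys : List A) → ∑ f (xs ++ ys) ≡ ∑ f xs + ∑ f ys
∑-++ f xs ys = trans (cong sum (map-++ f xs ys)) (sum-++ (map f xs) (map f ys))

∑-map : (f : B → ℕ) (g : A → B) (xs : List A) → ∑ f (map g xs) ≡ ∑ (f ∘ g) xs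
∑-map f g xs = cong sum (sym (map-∘ xs))

∑-↭ : (f : A → ℕ) {xs ys : List A} → xs ↭ ys → ∑ f xs ≡ ∑ f ys
∑-↭ f xs↭ys = sum-↭ (↭-map⁺ f xs↭ys)

∑-filter : (p : A → Bool) (f : A → ℕ) (xs : List A) →
           ∑ f (filter (λ x → p x ≟ true) xs) ≡ ∑ (λ x → if p x then f x else 0) xs
∑-filter p f []       = refl
∑-filter p f (x ∷ xs) with p x
... | true  = cong (f x +_) (∑-filter p f xs)
... | false = ∑-filter p f xs

∑-pairs : (f : A × B → ℕ) (xs : List A) (ys : List B) →
          ∑ f (concatMap (λ a → map (a ,_) ys) xs) ≡ ∑ (λ a → ∑ (λ b → f (a , b)) ys) xs
∑-pairs f []       ys = refl
∑-pairs f (x ∷ xs) ys = begin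
  ∑ f (map (x ,_) ys ++ concatMap (λ a → map (a ,_) ys) xs)      ≡⟨ ∑-++ f (map (x ,_) ys) _ ⟩
  ∑ f (map (x ,_) ys) + ∑ f (concatMap (λ a → map (a ,_) ys) xs) ≡⟨ cong₂ _+_ (∑-map f (x ,_) ys) (∑-pairs f xs ys) ⟩
  ∑ (λ b → f (x , b)) ys + ∑ (λ a → ∑ (λ b → f (a , b)) ys) xs   ∎
  where open ≡-Reasoning

does-≟-true : ∀ b → does (b ≟ true) ≡ b
does-≟-true true  = refl
does-≟-true false = refl

length-filter≡count : {P : A → Set} (P? : Decidable P) (xs : List A) →
                      length (filter P? xs) ≡ count (does ∘ P?) xs
length-filter≡count P? []       = refl
length-filter≡count P? (x ∷ xs) with does (P? x)
... | true  = cong suc (length-filter≡count P? xs)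
... | false = length-filter≡count P? xs

count-∧ˡ : ∀ c (p : A → Bool) (xs : List A) → count (λ x → c ∧ p x) xs ≡ (if c then count p xs else 0)
count-∧ˡ true  p xs       = refl
count-∧ˡ false p []       = refl
count-∧ˡ false p (x ∷ xs) = count-∧ˡ false p xs

count-filter : (p q : A → Bool) (xs : List A) →
               count q (filter (λ x → p x ≟ true) xs) ≡ count (λ x → p x ∧ q x) xs
count-filter p q xs = trans (∑-filter p (bit ∘ q) xs) (∑-cong (λ x → bit-∧ (p x) (q x)) xs)
  where
  bit-∧ : ∀ b c → (if b then bit c else 0) ≡ bit (b ∧ c)
  bit-∧ true  c = refl
  bit-∧ false c = refl

count≡0 : {p : A → Bool} {xs : List A} → (∀ {x} → x ∈ xs → p x ≡ false) → count p xs ≡ 0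
count≡0 {xs = []}     _         = refl
count≡0 {xs = x ∷ xs} all-false rewrite all-false (here refl) = count≡0 (all-false ∘ there)

count≤length : (p : A → Bool) (xs : List A) → count p xs ≤ length xs
count≤length p []       = z≤n
count≤length p (x ∷ xs) = +-mono-≤ (bit≤1 (p x)) (count≤length p xs)
  where
  bit≤1 : ∀ b → bit b ≤ 1
  bit≤1 true  = s≤s z≤n
  bit≤1 false = z≤n

edges : (A → A → Bool) → List A → ℕ
edges R []       = 0
edges R (w ∷ ws) = count (R w) ws + edges R ws

module _ {R : A → A → Bool} where

  edges≤C2 : ∀ xs → edges R xs ≤ length xs C 2
  edges≤C2 []       = z≤n
  edges≤C2 (w ∷ ws) = ≤-trans
    (+-mono-≤ (≤-trans (count≤length (R w) ws) (≤-reflexive (sym (nC1≡n (length ws))))) (edges≤C2 ws))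
    (≤-reflexive (nCk+nC[k+1]≡[n+1]C[k+1] (length ws) 1))

  edges-↭ : (∀ a b → R a b ≡ R b a) → {xs ys : List A} → xs ↭ ys → edges R xs ≡ edges R ys
  edges-↭ R-sym ↭.refl                         = refl
  edges-↭ R-sym (↭.prep w p)                   = cong₂ _+_ (∑-↭ (bit ∘ R w) p) (edges-↭ R-sym p)
  edges-↭ R-sym {x ∷ y ∷ xs} (↭.swap x y p) rewrite R-sym y x =
    trans (interchange (bit (R x y)) (count (R x) xs) (count (R y) xs) (edges R xs))
          (cong₂ _+_ (cong (bit (R x y) +_) (∑-↭ (bit ∘ R y) p))
                     (cong₂ _+_ (∑-↭ (bit ∘ R x) p) (edges-↭ R-sym p)))
  edges-↭ R-sym (↭.trans p q)                  = trans (edges-↭ R-sym p) (edges-↭ R-sym q)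

edges≥7⇒length≡5 : ∀ {m} → m ≤ 5 → 7 ≤ m C 2 → m ≡ 5
edges≥7⇒length≡5 {5} _ _ = refl
edges≥7⇒length≡5 {0} _ ()
edges≥7⇒length≡5 {1} _ ()
edges≥7⇒length≡5 {2} _ (s≤s ())
edges≥7⇒length≡5 {3} _ (s≤s (s≤s (s≤s ())))
edges≥7⇒length≡5 {4} _ (s≤s (s≤s (s≤s (s≤s (s≤s (s≤s ()))))))
edges≥7⇒length≡5 {suc (suc (suc (suc (suc (suc _)))))} (s≤s (s≤s (s≤s (s≤s (s≤s ()))))) _

C2≤1 : ∀ {m} → m ≤ 2 → m C 2 ≤ 1
C2≤1 z≤n             = z≤n
C2≤1 (s≤s z≤n)       = z≤n
C2≤1 (s≤s (s≤s z≤n)) = s≤s z≤n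

⊆-complement : {xs ys : List A} → Unique xs → xs ⊆ ys → ∃[ zs ] ys ↭ xs ++ zs
⊆-complement {xs = []}    {ys} _           _     = ys , ↭.refl
⊆-complement {xs = x ∷ xs}     (x∉xs ∷ xs!) xs⊆ys with ∈-∃++ (xs⊆ys (here refl))
... | us , vs , refl with ⊆-complement xs! xs⊆us++vs
  where
  xs⊆us++vs : xs ⊆ us ++ vs
  xs⊆us++vs u∈xs with ∈-resp-↭ (shift x us vs) (xs⊆ys (there u∈xs))
  ... | here refl      = ⊥-elim (All.lookup x∉xs u∈xs refl)
  ... | there u∈us++vs = u∈us++vs
... | zs , p = zs , ↭.trans (shift x us vs) (↭.prep x p)

Unique∧⊆⇒length≤ : {xs ys : List A} → Unique xs → xs ⊆ ys → length xs ≤ length ys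
Unique∧⊆⇒length≤ {xs = xs} xs! xs⊆ys with zs , p ← ⊆-complement xs! xs⊆ys =
  ≤-trans (m≤m+n (length xs) (length zs)) (≤-reflexive (sym (trans (↭-length p) (length-++ xs))))

Unique-resp-↭ : {xs ys : List A} → xs ↭ ys → Unique xs → Unique ys
Unique-resp-↭ p = ↭ₛ.Unique-resp-↭ (setoid _) (↭⇒↭ₛ p)

tabulate-of-length : ∀ {m} (xs : List A) → length xs ≡ m → ∃[ f ] xs ≡ tabulate {n = m} f
tabulate-of-length {m = zero}  []       refl = (λ ()) , refl
tabulate-of-length {m = suc m} (x ∷ xs) len with f , refl ← tabulate-of-length xs (suc-injective len) =
  (λ { zero → x ; (suc i) → f i }) , refl

Unique-tabulate⇒injective : ∀ {m} {f : Fin m → A} → Unique (tabulate f) → ∀ {i j} → f i ≡ f j → i ≡ j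
Unique-tabulate⇒injective _ {zero} {zero} _ = refl
Unique-tabulate⇒injective (f0∉ ∷ _) {zero} {suc j} f0≡fj = ⊥-elim (All.lookup f0∉ (∈-tabulate⁺ j) f0≡fj)
Unique-tabulate⇒injective (f0∉ ∷ _) {suc i} {zero} fi≡f0 = ⊥-elim (All.lookup f0∉ (∈-tabulate⁺ i) (sym fi≡f0))
Unique-tabulate⇒injective {f = f} (_ ∷ f∘suc!) {suc i} {suc j} fi≡fj =
  cong suc (Unique-tabulate⇒injective {f = f ∘ suc} f∘suc! fi≡fj)

module _ {n : ℕ} (G : Graph n) where

  neighbours-unique : ∀ x → Unique (neighbours G x)
  neighbours-unique x = Unique.filter⁺ (λ u → adj G x u ≟ true) (Unique.allFin⁺ n)

  ∈-neighbours⁺ : ∀ {x u} → Adjacent G x u → u ∈ neighbours G x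
  ∈-neighbours⁺ {x} {u} = ∈-filter⁺ (λ u → adj G x u ≟ true) (∈-allFin u)

  ∈-neighbours⁻ : ∀ {x u} → u ∈ neighbours G x → Adjacent G x u
  ∈-neighbours⁻ {x} = proj₂ ∘ ∈-filter⁻ (λ u → adj G x u ≟ true) {xs = allFin n}

  adjacent-sym : ∀ {x u} → Adjacent G x u → Adjacent G u x
  adjacent-sym {x} {u} = trans (Graph.sym G u x)

  adjacent⇒≢ : ∀ {x u} → Adjacent G x u → x ≢ u
  adjacent⇒≢ {x} x~u refl with () ← trans (sym x~u) (irrefl G x)

  count≤degree : ∀ y {L} → Unique L → count (adj G y) L ≤ degree G y
  count≤degree y {L} L! = subst (_≤ degree G y) length≡count
    (Unique∧⊆⇒length≤ (Unique.filter⁺ y~? L!) (∈-neighbours⁺ ∘ proj₂ ∘ ∈-filter⁻ y~? {xs = L}))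
    where
    y~? = λ u → adj G y u ≟ true
    length≡count : length (filter y~? L) ≡ count (adj G y) L
    length≡count = trans (length-filter≡count y~? L) (∑-cong (cong bit ∘ does-≟-true ∘ adj G y) L)

induced : ∀ {n m} → Graph n → (Fin m → Fin n) → Graph m
induced G a = record
  { adj    = λ i j → adj G (a i) (a j)
  ; sym    = λ i j → Graph.sym G (a i) (a j)
  ; irrefl = irrefl G ∘ a
  }

-- Triangles at a vertex are the edges of its neighbourhood

module _ {n : ℕ} where

  _<ᵇ_ : Fin n → Fin n → Bool
  a <ᵇ b = does (toℕ a <? toℕ b)

  ascendingEdges : (Fin n → Fin n → Bool) → List (Fin n) → ℕ
  ascendingEdges R L = ∑ (λ a → count (λ b → a <ᵇ b ∧ R a b) L) L

  module _ (R : Fin n → Fin n → Bool) (R-sym : ∀ a b → R a b ≡ R b a) (R-irrefl : ∀ a → R a a ≡ false) where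

    bit-split-by-order : ∀ a b → bit (a <ᵇ b ∧ R a b) + bit (b <ᵇ a ∧ R b a) ≡ bit (R a b)
    bit-split-by-order a b rewrite R-sym b a with R a b in a~b
    ... | false rewrite ∧-zeroʳ (a <ᵇ b) | ∧-zeroʳ (b <ᵇ a) = refl
    ... | true rewrite ∧-identityʳ (a <ᵇ b) | ∧-identityʳ (b <ᵇ a) with <-cmp (toℕ a) (toℕ b)
    ... | tri< a<b _ b≮a rewrite dec-true (toℕ a <? toℕ b) a<b | dec-false (toℕ b <? toℕ a) b≮a = refl
    ... | tri> a≮b _ b<a rewrite dec-false (toℕ a <? toℕ b) a≮b | dec-true (toℕ b <? toℕ a) b<a = refl
    ... | tri≈ _ a≡b _ with refl ← toℕ-injective a≡b with () ← trans (sym a~b) (R-irrefl a)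

    edges≡ascendingEdges : ∀ L → edges R L ≡ ascendingEdges R L
    edges≡ascendingEdges []       = refl
    edges≡ascendingEdges (w ∷ ws) = begin
      count (R w) ws + edges R ws            ≡⟨ cong₂ _+_ split (edges≡ascendingEdges ws) ⟩
      (after + before) + ascendingEdges R ws ≡⟨ +-assoc after before _ ⟩
      after + (before + ascendingEdges R ws) ≡⟨ cong₂ _+_ (cong (_+ after) (sym (no-loop w))) (sym (∑-+ ws)) ⟩
      ascendingEdges R (w ∷ ws)              ∎
      where
      open ≡-Reasoning
      after  = count (λ b → w <ᵇ b ∧ R w b) ws
      before = count (λ a → a <ᵇ w ∧ R a w) ws
      split : count (R w) ws ≡ after + before
      split = trans (sym (∑-cong (bit-split-by-order w) ws)) (∑-+ ws)
      no-loop : ∀ a → bit (a <ᵇ a ∧ R a a) ≡ 0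
      no-loop a rewrite R-irrefl a | ∧-zeroʳ (a <ᵇ a) = refl

∧-shuffle : ∀ l p q r → (l ∧ p) ∧ (q ∧ r) ≡ p ∧ (q ∧ (l ∧ r))
∧-shuffle true  p     q     r = refl
∧-shuffle false false q     r = refl
∧-shuffle false true  false r = refl
∧-shuffle false true  true  r = refl

module _ {n : ℕ} (G : Graph n) (v : Fin n) where

  private
    V = allFin n
    N = neighbours G v
    V×V = concatMap (λ a → map (a ,_) V) V

    ascending : Fin n → Fin n → Bool
    ascending a b = a <ᵇ b ∧ adj G a b

  k3≡ascendingEdges : k3 G v ≡ ascendingEdges (adj G) N
  k3≡ascendingEdges = begin
    k3 G v
      ≡⟨ trans (length-filter≡count _ V×V) (∑-pairs _ V V) ⟩
    ∑ (λ a → count (λ b → (a <ᵇ b ∧ does (adj G v a ≟ true)) ∧ (does (adj G v b ≟ true) ∧ does (adj G a b ≟ true))) V) V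
      ≡⟨ ∑-cong (λ a → ∑-cong (λ b → cong bit (triangle-test a b)) V) V ⟩
    ∑ (λ a → count (λ b → adj G v a ∧ (adj G v b ∧ ascending a b)) V) V
      ≡⟨ ∑-cong (λ a → count-∧ˡ (adj G v a) _ V) V ⟩
    ∑ (λ a → if adj G v a then count (λ b → adj G v b ∧ ascending a b) V else 0) V
      ≡⟨ sym (∑-filter (adj G v) _ V) ⟩
    ∑ (λ a → count (λ b → adj G v b ∧ ascending a b) V) N
      ≡⟨ sym (∑-cong (λ a → count-filter (adj G v) (ascending a) V) N) ⟩
    ascendingEdges (adj G) N ∎
    where
    open ≡-Reasoning
    triangle-test : ∀ a b → (a <ᵇ b ∧ does (adj G v a ≟ true)) ∧ (does (adj G v b ≟ true) ∧ does (adj G a b ≟ true))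
                          ≡ adj G v a ∧ (adj G v b ∧ ascending a b)
    triangle-test a b rewrite does-≟-true (adj G v a) | does-≟-true (adj G v b) | does-≟-true (adj G a b) =
      ∧-shuffle (a <ᵇ b) (adj G v a) (adj G v b) (adj G a b)

  k3≡edges : k3 G v ≡ edges (adj G) N
  k3≡edges = trans k3≡ascendingEdges (sym (edges≡ascendingEdges (adj G) (Graph.sym G) (irrefl G) N))

-- Graphs on five vertices

BoolRel : ℕ → Set
BoolRel m = Fin m → Fin m → Bool

module _ {m : ℕ} (R : BoolRel m) where

  IsK4 : Fin m → Fin m → Fin m → Fin m → Set
  IsK4 a b c d = R a b ≡ true × R a c ≡ true × R a d ≡ true × R b c ≡ true × R b d ≡ true × R c d ≡ true

  K4Free : Set
  K4Free = ∀ a b c d → ¬ IsK4 a b c d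

  degreeIn : Fin m → ℕ
  degreeIn j = count (R j) (allFin m)

  HeavyWedge : Set
  HeavyWedge = ∃[ i ] ∃[ j ] ∃[ k ]
    R i j ≡ true × R i k ≡ true × j ≢ k × (∀ l → R i l ≡ true → l ≡ j ⊎ l ≡ k) ×
    bit (R j k) + 6 ≤ degreeIn j + degreeIn k

  private
    adjacent? : ∀ a b → Dec (R a b ≡ true)
    adjacent? a b = R a b ≟ true

  k4Free? : Dec K4Free
  k4Free? = all? λ a → all? λ b → all? λ c → all? λ d → ¬?
    (adjacent? a b ×-dec adjacent? a c ×-dec adjacent? a d ×-dec adjacent? b c ×-dec adjacent? b d ×-dec adjacent? c d)

  heavyWedge? : Dec HeavyWedge
  heavyWedge? = any? λ i → any? λ j → any? λ k →
    adjacent? i j ×-dec adjacent? i k ×-dec ¬? (j ≟ᶠ k) ×-dec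
    all? (λ l → adjacent? i l →-dec (l ≟ᶠ j ⊎-dec l ≟ᶠ k)) ×-dec
    bit (R j k) + 6 ≤? degreeIn j + degreeIn k

module _ {m : ℕ} {R S : BoolRel m} (R≗S : ∀ a b → R a b ≡ S a b) where

  edges-cong : ∀ xs → edges R xs ≡ edges S xs
  edges-cong []       = refl
  edges-cong (w ∷ ws) = cong₂ _+_ (∑-cong (cong bit ∘ R≗S w) ws) (edges-cong ws)

  K4Free-cong : K4Free R → K4Free S
  K4Free-cong R-free a b c d (ab , ac , ad , bc , bd , cd) =
    R-free a b c d (back ab , back ac , back ad , back bc , back bd , back cd)
    where
    back : ∀ {x y} → S x y ≡ true → R x y ≡ true
    back {x} {y} = trans (R≗S x y)

  HeavyWedge-cong : HeavyWedge R → HeavyWedge S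
  HeavyWedge-cong (i , j , k , ij , ik , j≢k , only , heavy) =
    i , j , k , trans (sym (R≗S i j)) ij , trans (sym (R≗S i k)) ik , j≢k ,
    (λ l il → only l (trans (R≗S i l) il)) ,
    subst₂ _≤_ (cong (λ b → bit b + 6) (R≗S j k)) (cong₂ _+_ (degreeIn-cong j) (degreeIn-cong k)) heavy
    where
    degreeIn-cong : ∀ j → degreeIn R j ≡ degreeIn S j
    degreeIn-cong j = ∑-cong (cong bit ∘ R≗S j) (allFin m)

fromBits : Vec Bool 10 → BoolRel 5
fromBits (b01 ∷ b02 ∷ b03 ∷ b04 ∷ b12 ∷ b13 ∷ b14 ∷ b23 ∷ b24 ∷ b34 ∷ []) i j = lookup (lookup matrix i) j
  where
  matrix : Vec (Vec Bool 5) 5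
  matrix = (false ∷ b01   ∷ b02   ∷ b03   ∷ b04   ∷ [])
         ∷ (b01   ∷ false ∷ b12   ∷ b13   ∷ b14   ∷ [])
         ∷ (b02   ∷ b12   ∷ false ∷ b23   ∷ b24   ∷ [])
         ∷ (b03   ∷ b13   ∷ b23   ∷ false ∷ b34   ∷ [])
         ∷ (b04   ∷ b14   ∷ b24   ∷ b34   ∷ false ∷ [])
         ∷ []

toBits : BoolRel 5 → Vec Bool 10
toBits R = R 0F 1F ∷ R 0F 2F ∷ R 0F 3F ∷ R 0F 4F ∷ R 1F 2F ∷ R 1F 3F ∷ R 1F 4F ∷ R 2F 3F ∷ R 2F 4F ∷ R 3F 4F ∷ []

module _ (H : Graph 5) where

  private
    loop : ∀ i → false ≡ adj H i i
    loop = sym ∘ irrefl H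
    flip : ∀ i j → adj H i j ≡ adj H j i
    flip = Graph.sym H

  fromBits-toBits : ∀ i j → fromBits (toBits (adj H)) i j ≡ adj H i j
  fromBits-toBits 0F = λ { 0F → loop 0F    ; 1F → refl       ; 2F → refl       ; 3F → refl       ; 4F → refl }
  fromBits-toBits 1F = λ { 0F → flip 0F 1F ; 1F → loop 1F    ; 2F → refl       ; 3F → refl       ; 4F → refl }
  fromBits-toBits 2F = λ { 0F → flip 0F 2F ; 1F → flip 1F 2F ; 2F → loop 2F    ; 3F → refl       ; 4F → refl }
  fromBits-toBits 3F = λ { 0F → flip 0F 3F ; 1F → flip 1F 3F ; 2F → flip 2F 3F ; 3F → loop 3F    ; 4F → refl }
  fromBits-toBits 4F = λ { 0F → flip 0F 4F ; 1F → flip 1F 4F ; 2F → flip 2F 4F ; 3F → flip 3F 4F ; 4F → loop 4F }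

all-bits? : ∀ {m} {P : Vec Bool m → Set} → (∀ bs → Dec (P bs)) → Dec (∀ bs → P bs)
all-bits? {zero}  P? = map′ (λ p → λ { [] → p }) (λ h → h []) (P? [])
all-bits? {suc m} P? = map′ (λ (t , f) → λ { (true ∷ bs) → t bs ; (false ∷ bs) → f bs })
  (λ h → h ∘ (true ∷_) , h ∘ (false ∷_))
  (all-bits? (P? ∘ (true ∷_)) ×-dec all-bits? (P? ∘ (false ∷_)))

heavyWedge-fromBits : ∀ bs → edges (fromBits bs) (allFin 5) ≡ 7 → K4Free (fromBits bs) → HeavyWedge (fromBits bs)
heavyWedge-fromBits = from-yes (all-bits? λ bs →
  edges (fromBits bs) (allFin 5) ≟ℕ 7 →-dec k4Free? (fromBits bs) →-dec heavyWedge? (fromBits bs))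

heavyWedge-exists : (H : Graph 5) → edges (adj H) (allFin 5) ≡ 7 → K4Free (adj H) → HeavyWedge (adj H)
heavyWedge-exists H seven k4Free = HeavyWedge-cong same
  (heavyWedge-fromBits (toBits (adj H))
    (trans (edges-cong same (allFin 5)) seven) (K4Free-cong (λ a b → sym (same a b)) k4Free))
  where
  same = fromBits-toBits H

-- Few triangles at the centre of a heavy wedge

wedge-arithmetic : ∀ {t cy cz dy dz e} →
  1 + (dy + cy) ≤ 5 → 1 + (dz + cz) ≤ 5 → t + 6 ≤ dy + dz → e ≤ 1 →
  2 + ((t + cy) + (cz + e)) ≤ 5
wedge-arithmetic {t} {cy} {cz} {dy} {dz} {e} y-room z-room heavy e≤1 = begin
  2 + ((t + cy) + (cz + e)) ≡⟨ regroup t cy cz e ⟩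
  ((t + cy + cz) + e) + 2   ≤⟨ +-monoˡ-≤ 2 (+-mono-≤ t+cy+cz≤2 e≤1) ⟩
  5                         ∎
  where
  open ≤-Reasoning
  regroup : ∀ t cy cz e → 2 + ((t + cy) + (cz + e)) ≡ ((t + cy + cz) + e) + 2
  regroup = solve-∀
  shuffle : ∀ t cy cz → (t + cy + cz) + 6 ≡ (t + 6) + (cy + cz)
  shuffle = solve-∀
  interleave : ∀ dy dz cy cz → (dy + dz) + (cy + cz) ≡ (dy + cy) + (dz + cz)
  interleave = solve-∀
  t+cy+cz≤2 : t + cy + cz ≤ 2
  t+cy+cz≤2 = +-cancelʳ-≤ 6 _ _ (begin
    (t + cy + cz) + 6     ≡⟨ shuffle t cy cz ⟩
    (t + 6) + (cy + cz)   ≤⟨ +-monoˡ-≤ (cy + cz) heavy ⟩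
    (dy + dz) + (cy + cz) ≡⟨ interleave dy dz cy cz ⟩
    (dy + cy) + (dz + cz) ≤⟨ +-mono-≤ (s≤s⁻¹ y-room) (s≤s⁻¹ z-room) ⟩
    8                     ∎)

module _ {n : ℕ} (G : Graph n) (Δ≤5 : MaxDegreeAtMost G 5) {v x y z : Fin n}
         (v~x : Adjacent G v x) (x~y : Adjacent G x y) (x~z : Adjacent G x z)
         (v~y : Adjacent G v y) (v~z : Adjacent G v z) (y≢z : y ≢ z)
         (only : ∀ u → Adjacent G v u → Adjacent G x u → u ≡ y ⊎ u ≡ z) where

  private
    Nv = neighbours G v
    Nx = neighbours G x

    wedge-unique : Unique (v ∷ y ∷ z ∷ [])
    wedge-unique = (adjacent⇒≢ G v~y ∷ adjacent⇒≢ G v~z ∷ []) ∷ (y≢z ∷ []) ∷ [] ∷ []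

    wedge⊆Nx : ∀ {u} → u ∈ v ∷ y ∷ z ∷ [] → u ∈ Nx
    wedge⊆Nx (here refl)                 = ∈-neighbours⁺ G (adjacent-sym G v~x)
    wedge⊆Nx (there (here refl))         = ∈-neighbours⁺ G x~y
    wedge⊆Nx (there (there (here refl))) = ∈-neighbours⁺ G x~z

  module _ {O : List (Fin n)} (Nx↭ : Nx ↭ v ∷ y ∷ z ∷ O) where

    private
      vyzO-unique : Unique (v ∷ y ∷ z ∷ O)
      vyzO-unique = Unique-resp-↭ Nx↭ (neighbours-unique G x)

      O⊆Nx : ∀ {u} → u ∈ O → u ∈ Nx
      O⊆Nx = ∈-resp-↭ (↭-sym Nx↭) ∘ there ∘ there ∘ there

      O-avoids-Nv : ∀ {u} → u ∈ O → adj G v u ≡ false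
      O-avoids-Nv {u} u∈O with adj G v u in v~u
      ... | false = refl
      ... | true  with only u v~u (∈-neighbours⁻ G (O⊆Nx u∈O)) | vyzO-unique
      ...   | inj₁ refl | _ ∷ (_ ∷ y∉O) ∷ _ = ⊥-elim (All.lookup y∉O u∈O refl)
      ...   | inj₂ refl | _ ∷ _ ∷ z∉O ∷ _   = ⊥-elim (All.lookup z∉O u∈O refl)

      vNvO-unique : Unique (v ∷ Nv ++ O)
      vNvO-unique with (_ ∷ _ ∷ v∉O) ∷ _ ∷ _ ∷ O! ← vyzO-unique =
        All-++⁺ (All.tabulate (adjacent⇒≢ G ∘ ∈-neighbours⁻ G)) v∉O
        ∷ Unique.++⁺ (neighbours-unique G v) O! Nv-disjoint-O
        where
        Nv-disjoint-O : ∀ {u} → u ∈ Nv × u ∈ O → ⊥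
        Nv-disjoint-O (u∈Nv , u∈O) with () ← trans (sym (∈-neighbours⁻ G u∈Nv)) (O-avoids-Nv u∈O)

    degree-budget : ∀ {w} → Adjacent G w v → 1 + (count (adj G w) Nv + count (adj G w) O) ≤ 5
    degree-budget {w} w~v = ≤-trans (≤-reflexive unfold) (≤-trans (count≤degree G w vNvO-unique) (Δ≤5 w))
      where
      unfold : 1 + (count (adj G w) Nv + count (adj G w) O) ≡ count (adj G w) (v ∷ Nv ++ O)
      unfold rewrite w~v = cong suc (sym (∑-++ _ Nv O))

    O-length≤2 : length O ≤ 2
    O-length≤2 = s≤s⁻¹ (s≤s⁻¹ (s≤s⁻¹ (subst (_≤ 5) (↭-length Nx↭) (Δ≤5 x))))

    k3-split : k3 G x ≡ 2 + ((bit (adj G y z) + count (adj G y) O) + (count (adj G z) O + edges (adj G) O))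
    k3-split = begin
      k3 G x                        ≡⟨ k3≡edges G x ⟩
      edges (adj G) Nx              ≡⟨ edges-↭ (Graph.sym G) Nx↭ ⟩
      edges (adj G) (v ∷ y ∷ z ∷ O) ≡⟨ cong (_+ edges (adj G) (y ∷ z ∷ O)) v-row ⟩
      2 + edges (adj G) (y ∷ z ∷ O) ∎
      where
      open ≡-Reasoning
      v-row : count (adj G v) (y ∷ z ∷ O) ≡ 2
      v-row rewrite v~y | v~z | count≡0 O-avoids-Nv = refl

  heavyWedge⇒k3≤5 : bit (adj G y z) + 6 ≤ count (adj G y) Nv + count (adj G z) Nv → k3 G x ≤ 5
  heavyWedge⇒k3≤5 heavy with O , Nx↭ ← ⊆-complement wedge-unique wedge⊆Nx =
    subst (_≤ 5) (sym (k3-split Nx↭))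
      (wedge-arithmetic (degree-budget Nx↭ (adjacent-sym G v~y)) (degree-budget Nx↭ (adjacent-sym G v~z)) heavy
                        (≤-trans (edges≤C2 O) (C2≤1 (O-length≤2 Nx↭))))

module _ {n : ℕ} (G : Graph n) (Δ≤5 : MaxDegreeAtMost G 5) (no-K5 : CliqueNumberAtMost4 G) {v : Fin n}
         {a : Fin 5 → Fin n} (N≡a : neighbours G v ≡ tabulate a) where

  private
    v~a : ∀ l → Adjacent G v (a l)
    v~a l = ∈-neighbours⁻ G (subst (a l ∈_) (sym N≡a) (∈-tabulate⁺ {f = a} l))

    a-injective : ∀ {i j} → a i ≡ a j → i ≡ j
    a-injective = Unique-tabulate⇒injective (subst Unique N≡a (neighbours-unique G v))

    link-K4Free : K4Free (adj (induced G a))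
    link-K4Free p q r s (pq , pr , ps , qr , qs , rs) =
      no-K5 v (a p) (a q) (a r) (a s) (v~a p , v~a q , v~a r , v~a s , pq , pr , ps , qr , qs , rs)

  -- Matching on the wedge here, instead of with-abstracting over heavyWedge-exists, keeps the
  -- type checker from unfolding the exhaustive check behind it.
  centre-of-heavy-wedge : HeavyWedge (adj (induced G a)) → Σ (Fin n) (λ x → Adjacent G v x × k3 G x ≤ 5)
  centre-of-heavy-wedge (i , j , k , ij , ik , j≢k , only , heavy) =
    a i , v~a i , heavyWedge⇒k3≤5 G Δ≤5 (v~a i) ij ik (v~a j) (v~a k) (j≢k ∘ a-injective) only-y-z heavy-in-G
    where
    only-y-z : ∀ u → Adjacent G v u → Adjacent G (a i) u → u ≡ a j ⊎ u ≡ a k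
    only-y-z u v~u x~u with l , refl ← ∈-tabulate⁻ {f = a} (subst (u ∈_) N≡a (∈-neighbours⁺ G v~u)) =
      Sum.map (cong a) (cong a) (only l x~u)
    heavy-in-G : bit (adj G (a j) (a k)) + 6 ≤ count (adj G (a j)) (neighbours G v) + count (adj G (a k)) (neighbours G v)
    heavy-in-G = subst (λ L → bit (adj G (a j) (a k)) + 6 ≤ count (adj G (a j)) L + count (adj G (a k)) L) (sym N≡a) heavy

  neighbour-with-few-triangles : edges (adj G) (neighbours G v) ≡ 7 → Σ (Fin n) (λ x → Adjacent G v x × k3 G x ≤ 5)
  neighbour-with-few-triangles seven =
    centre-of-heavy-wedge (heavyWedge-exists (induced G a) (subst (λ L → edges (adj G) L ≡ 7) N≡a seven) link-K4Free)

lemma6p6 : ∀ (n : ℕ) (G : Graph n) → MaxDegreeAtMost G 5 → CliqueNumberAtMost4 G →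
    ∀ (v : Fin n) → k3 G v ≡ 7 →
      Σ (Fin n) (λ x → Adjacent G v x × k3 G x ≤ 5)
lemma6p6 n G Δ≤5 no-K5 v k3≡7 = neighbour-with-few-triangles G Δ≤5 no-K5 {a = proj₁ N-tabulated} (proj₂ N-tabulated) seven
  where
  N = neighbours G v
  seven : edges (adj G) N ≡ 7
  seven = trans (sym (k3≡edges G v)) k3≡7
  five : length N ≡ 5
  five = edges≥7⇒length≡5 (Δ≤5 v) (subst (_≤ length N C 2) seven (edges≤C2 N))
  N-tabulated : ∃[ a ] N ≡ tabulate a
  N-tabulated = tabulate-of-length N five
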